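{- For any integers $k\ge 2$ and $v\ge 1$, the constraint $\sum_{i=1}^{k-1}x_i+\frac{1}{v}x_k\ge 1$ (in variables $x_1,\dots,x_k$) is $k$-roundable.
   Context: For a real $\rho>1$ and a nonnegative real vector $\alpha$, the constraint $\alpha\cdot x\ge1$ is $\rho$-roundable if for every nonnegative real vector $x$, $\alpha\cdot x\ge1$ implies $\alpha\cdot\lfloor\rho x\rfloor\ge1$ (floor componentwise). -}

module Defs where

open import Level using (0ℓ)
open import Data.Nat as ℕ using (ℕ; zero; suc; _≡ᵇ_)
open import Data.Integer as ℤ using (ℤ; +_; -[1+_])
open import Data.Fin using (Fin; toℕ)
import Data.Fin as Fin
open import Data.Bool using (if_then_else_)
open import Data.Product using (_×_; ∃)
open import Relation.Binary.PropositionalEquality using (_≡_)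
open import Relation.Binary.Core using (Rel)
open import Relation.Binary.Structures using (IsTotalOrder)
open import Relation.Nullary using (¬_)
open import Algebra.Core using (Op₁; Op₂)
open import Algebra.Structures using (IsCommutativeRing)

-- The real numbers, given axiomatically as a complete ordered field
-- (Dedekind/sup-completeness).  All models are isomorphic to ℝ, so
-- quantifying over every such model is the same as talking about ℝ.

record RealField : Set₁ where
  infixl 6 _+_
  infixl 7 _*_
  infix  4 _≤_ _<_
  field
    Carrier : Set
    _+_ _*_ : Op₂ Carrier
    -_      : Op₁ Carrier
    0# 1#   : Carrier
    isCommutativeRing : IsCommutativeRing _≡_ _+_ _*_ -_ 0# 1#
    _⁻¹     : Op₁ Carrier
    ⁻¹-inverse : ∀ x → ¬ x ≡ 0# → x * (x ⁻¹) ≡ 1#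
    0≢1     : ¬ 0# ≡ 1#
    _≤_     : Rel Carrier 0ℓ
    isTotalOrder : IsTotalOrder _≡_ _≤_
    +-monoˡ-≤ : ∀ {x y} z → x ≤ y → x + z ≤ y + z
    *-nonneg  : ∀ {x y} → 0# ≤ x → 0# ≤ y → 0# ≤ x * y
    sup-complete : (P : Carrier → Set) → ∃ P → ∃ (λ b → ∀ y → P y → y ≤ b) →
                   ∃ (λ s → (∀ y → P y → y ≤ s) × (∀ b → (∀ y → P y → y ≤ b) → s ≤ b))

  _<_ : Rel Carrier 0ℓ
  x < y = x ≤ y × ¬ x ≡ y

module RealOps (R : RealField) where
  open RealField R

  fromℕ : ℕ → Carrier
  fromℕ zero    = 0#
  fromℕ (suc n) = 1# + fromℕ n

  fromℤ : ℤ → Carrier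
  fromℤ (+ n)      = fromℕ n
  fromℤ -[1+ n ]   = - (fromℕ (suc n))

  IsFloor : (Carrier → ℤ) → Set
  IsFloor f = ∀ x → fromℤ (f x) ≤ x × x < fromℤ (f x) + 1#

  Σ : ∀ {n} → (Fin n → Carrier) → Carrier
  Σ {zero}  f = 0#
  Σ {suc n} f = f Fin.zero + Σ (λ i → f (Fin.suc i))

  _·_ : ∀ {n} → (Fin n → Carrier) → (Fin n → Carrier) → Carrier
  α · x = Σ (λ i → α i * x i)

  Nonneg : ∀ {n} → (Fin n → Carrier) → Set
  Nonneg x = ∀ i → 0# ≤ x i

  Roundable : (Carrier → ℤ) → Carrier → ∀ {n} → (Fin n → Carrier) → Set
  Roundable ⌊_⌋ ρ {n} α =
    (x : Fin n → Carrier) → Nonneg x → 1# ≤ α · x →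
    1# ≤ α · (λ i → fromℤ ⌊ ρ * x i ⌋)

  -- α = (1, …, 1, 1/v) of length k: coefficient 1 on x_1..x_{k-1},
  -- coefficient 1/v on x_k (the last index, toℕ i = k-1).
  αkv : (k v : ℕ) → Fin k → Carrier
  αkv k v i = if suc (toℕ i) ≡ᵇ k then (fromℕ v) ⁻¹ else 1#

-- If k x_i ≥ 1 for some i < k, then ⌊k x_i⌋ ≥ 1 already makes the rounded sum at least 1,
-- since every rounded term is nonnegative.  Otherwise k x_i ≤ 1 for all i < k, and multiplying
-- the constraint by k gives k ≤ (k - 1) + k x_k / v, that is v ≤ k x_k; as v is an integer,
-- v ≤ ⌊k x_k⌋, so the last term alone gives ⌊k x_k⌋ / v ≥ 1.
module Submission where

open import Defs
import Data.Nat as ℕ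
open ℕ using (ℕ; zero; suc)
import Data.Nat.Properties as ℕ
open import Data.Integer as ℤ using (ℤ; -[1+_])
open import Data.Fin using (Fin; toℕ; inject₁)
import Data.Fin as Fin
open import Data.Bool using (true; false)
open import Data.Product using (_,_; proj₂; ∃)
open import Data.Sum using (_⊎_; inj₁; inj₂)
open import Data.Empty using (⊥-elim)
open import Function using (_∘_)
open import Relation.Nullary using (¬_; yes; no)
open import Relation.Binary.PropositionalEquality using (_≡_; refl; sym; trans; cong; cong₂; subst₂)
open import Relation.Binary.Bundles using (Poset)
open import Relation.Binary.Structures using (IsTotalOrder)
open import Algebra.Bundles using (CommutativeRing)
open import Algebra.Structures using (IsCommutativeRing)
import Algebra.Properties.Ring as RingProperties
import Algebra.Properties.CommutativeSemigroup as CommutativeSemigroupProperties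
import Relation.Binary.Reasoning.PartialOrder as PosetReasoning

∃⊎∀ : ∀ {n} {P Q : Fin n → Set} → (∀ i → P i ⊎ Q i) → ∃ P ⊎ (∀ i → Q i)
∃⊎∀ {zero}          P⊎Q = inj₂ λ ()
∃⊎∀ {suc n} {P} {Q} P⊎Q with P⊎Q Fin.zero | ∃⊎∀ {P = P ∘ Fin.suc} {Q ∘ Fin.suc} (P⊎Q ∘ Fin.suc)
... | inj₁ p | _            = inj₁ (Fin.zero , p)
... | inj₂ _ | inj₁ (j , p) = inj₁ (Fin.suc j , p)
... | inj₂ q | inj₂ qs      = inj₂ λ { Fin.zero → q ; (Fin.suc i) → qs i }

toℕ-inject₁-≡ᵇ : ∀ m (i : Fin m) → (toℕ (inject₁ i) ℕ.≡ᵇ m) ≡ false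
toℕ-inject₁-≡ᵇ (suc m) Fin.zero    = refl
toℕ-inject₁-≡ᵇ (suc m) (Fin.suc i) = toℕ-inject₁-≡ᵇ m i

toℕ-fromℕ-≡ᵇ : ∀ m → (toℕ (Fin.fromℕ m) ℕ.≡ᵇ m) ≡ true
toℕ-fromℕ-≡ᵇ zero    = refl
toℕ-fromℕ-≡ᵇ (suc m) = toℕ-fromℕ-≡ᵇ m

module OrderedField (R : RealField) where
  open RealField R
  open RealOps R
  open IsCommutativeRing isCommutativeRing
    using (+-assoc; +-comm; *-comm; *-assoc; distribˡ; zeroʳ;
           +-identityˡ; +-identityʳ; *-identityˡ; *-identityʳ; -‿inverseˡ; -‿inverseʳ)
  open IsTotalOrder isTotalOrder using (total; antisym)
    renaming (refl to ≤-refl; trans to ≤-trans)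

  commutativeRing : CommutativeRing _ _
  commutativeRing = record { isCommutativeRing = isCommutativeRing }

  open RingProperties (CommutativeRing.ring commutativeRing) using (-1*x≈-x; -‿involutive)

  poset : Poset _ _ _
  poset = record { isPartialOrder = IsTotalOrder.isPartialOrder isTotalOrder }

  open PosetReasoning poset

  <⇒≱ : ∀ {x y} → x < y → ¬ y ≤ x
  <⇒≱ (x≤y , x≢y) y≤x = x≢y (antisym x≤y y≤x)

  ≤-<-trans : ∀ {x y z} → x ≤ y → y < z → x < z
  ≤-<-trans x≤y (y≤z , y≢z) = ≤-trans x≤y y≤z , λ { refl → y≢z (antisym y≤z x≤y) }

  +-monoʳ-≤ : ∀ {x y} z → x ≤ y → z + x ≤ z + y
  +-monoʳ-≤ {x} {y} z x≤y = subst₂ _≤_ (+-comm x z) (+-comm y z) (+-monoˡ-≤ z x≤y)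

  +-mono-≤ : ∀ {x y u v} → x ≤ y → u ≤ v → x + u ≤ y + v
  +-mono-≤ {y = y} {u} x≤y u≤v = ≤-trans (+-monoˡ-≤ u x≤y) (+-monoʳ-≤ y u≤v)

  x≤x+y : ∀ x {y} → 0# ≤ y → x ≤ x + y
  x≤x+y x 0≤y = subst₂ _≤_ (+-identityʳ x) refl (+-monoʳ-≤ x 0≤y)

  +-cancelʳ-≤ : ∀ {x y} z → x + z ≤ y + z → x ≤ y
  +-cancelʳ-≤ {x} {y} z x+z≤y+z = subst₂ _≤_ (+-z-z x) (+-z-z y) (+-monoˡ-≤ (- z) x+z≤y+z)
    where
    +-z-z : ∀ t → t + z + - z ≡ t
    +-z-z t = trans (+-assoc t z (- z)) (trans (cong (t +_) (-‿inverseʳ z)) (+-identityʳ t))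

  +-cancelˡ-≤ : ∀ {x y} z → z + x ≤ z + y → x ≤ y
  +-cancelˡ-≤ {x} {y} z z+x≤z+y = +-cancelʳ-≤ z (subst₂ _≤_ (+-comm z x) (+-comm z y) z+x≤z+y)

  x≤y⇒0≤y-x : ∀ {x y} → x ≤ y → 0# ≤ y + - x
  x≤y⇒0≤y-x {x} x≤y = subst₂ _≤_ (-‿inverseʳ x) refl (+-monoˡ-≤ (- x) x≤y)

  -- If 1 ≤ 0 then 0 ≤ -1, so 0 ≤ (-1)·(-1) = 1.
  0≤1 : 0# ≤ 1#
  0≤1 with total 0# 1#
  ... | inj₁ 0≤1 = 0≤1
  ... | inj₂ 1≤0 = subst₂ _≤_ refl -1*-1≡1 (*-nonneg 0≤-1 0≤-1)
    where
    0≤-1 : 0# ≤ - 1#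
    0≤-1 = subst₂ _≤_ refl (+-identityˡ (- 1#)) (x≤y⇒0≤y-x 1≤0)
    -1*-1≡1 : - 1# * - 1# ≡ 1#
    -1*-1≡1 = trans (-1*x≈-x (- 1#)) (-‿involutive 1#)

  *-monoˡ-≤ : ∀ {x y} z → 0# ≤ z → x ≤ y → z * x ≤ z * y
  *-monoˡ-≤ {x} {y} z 0≤z x≤y = begin
    z * x                        ≡⟨ +-identityˡ (z * x) ⟨
    0# + z * x                   ≤⟨ +-monoˡ-≤ (z * x) (*-nonneg 0≤z (x≤y⇒0≤y-x x≤y)) ⟩
    z * (y + - x) + z * x        ≡⟨ distribˡ z (y + - x) x ⟨
    z * (y + - x + x)            ≡⟨ cong (z *_) (+-assoc y (- x) x) ⟩
    z * (y + (- x + x))          ≡⟨ cong (λ t → z * (y + t)) (-‿inverseˡ x) ⟩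
    z * (y + 0#)                 ≡⟨ cong (z *_) (+-identityʳ y) ⟩
    z * y                        ∎

  0≤x⇒0≤x⁻¹ : ∀ {x} → 0# ≤ x → ¬ x ≡ 0# → 0# ≤ x ⁻¹
  0≤x⇒0≤x⁻¹ {x} 0≤x x≢0 with total 0# (x ⁻¹)
  ... | inj₁ 0≤x⁻¹ = 0≤x⁻¹
  ... | inj₂ x⁻¹≤0 = ⊥-elim (0≢1 (antisym 0≤1 1≤0))
    where
    1≤0 : 1# ≤ 0#
    1≤0 = subst₂ _≤_ (⁻¹-inverse x x≢0) (zeroʳ x) (*-monoˡ-≤ x 0≤x x⁻¹≤0)

  x≤y⇒1≤x⁻¹*y : ∀ {x y} → 0# ≤ x → ¬ x ≡ 0# → x ≤ y → 1# ≤ x ⁻¹ * y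
  x≤y⇒1≤x⁻¹*y {x} {y} 0≤x x≢0 x≤y = begin
    1#          ≡⟨ ⁻¹-inverse x x≢0 ⟨
    x * x ⁻¹    ≡⟨ *-comm x (x ⁻¹) ⟩
    x ⁻¹ * x    ≤⟨ *-monoˡ-≤ (x ⁻¹) (0≤x⇒0≤x⁻¹ 0≤x x≢0) x≤y ⟩
    x ⁻¹ * y    ∎

  1≤x⁻¹*y⇒x≤y : ∀ {x y} → 0# ≤ x → ¬ x ≡ 0# → 1# ≤ x ⁻¹ * y → x ≤ y
  1≤x⁻¹*y⇒x≤y {x} {y} 0≤x x≢0 1≤x⁻¹y = begin
    x                ≡⟨ *-identityʳ x ⟨
    x * 1#           ≤⟨ *-monoˡ-≤ x 0≤x 1≤x⁻¹y ⟩
    x * (x ⁻¹ * y)   ≡⟨ *-assoc x (x ⁻¹) y ⟨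
    x * x ⁻¹ * y     ≡⟨ cong (_* y) (⁻¹-inverse x x≢0) ⟩
    1# * y           ≡⟨ *-identityˡ y ⟩
    y                ∎

  fromℕ-nonneg : ∀ n → 0# ≤ fromℕ n
  fromℕ-nonneg zero    = ≤-refl
  fromℕ-nonneg (suc n) = subst₂ _≤_ (+-identityˡ 0#) refl (+-mono-≤ 0≤1 (fromℕ-nonneg n))

  fromℕ-mono-≤ : ∀ {m n} → m ℕ.≤ n → fromℕ m ≤ fromℕ n
  fromℕ-mono-≤ {n = n} ℕ.z≤n   = fromℕ-nonneg n
  fromℕ-mono-≤ (ℕ.s≤s m≤n) = +-monoʳ-≤ 1# (fromℕ-mono-≤ m≤n)

  fromℕ-suc≢0 : ∀ n → ¬ fromℕ (suc n) ≡ 0#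
  fromℕ-suc≢0 n 1+n≡0 = 0≢1 (antisym 0≤1 (subst₂ _≤_ refl 1+n≡0 (x≤x+y 1# (fromℕ-nonneg n))))

  n<z+1⇒n≤z : ∀ n z → fromℕ n < fromℤ z + 1# → fromℕ n ≤ fromℤ z
  n<z+1⇒n≤z n (ℤ.+ m) n<m+1 with n ℕ.≤? m
  ... | yes n≤m = fromℕ-mono-≤ n≤m
  ... | no  n≰m = ⊥-elim (<⇒≱ n<m+1 (subst₂ _≤_ (+-comm 1# (fromℕ m)) refl (fromℕ-mono-≤ (ℕ.≰⇒> n≰m))))
  n<z+1⇒n≤z n -[1+ m ] n<z+1 = ⊥-elim (<⇒≱ n<z+1 (≤-trans z+1≤0 (fromℕ-nonneg n)))
    where
    z+1≤0 : - fromℕ (suc m) + 1# ≤ 0#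
    z+1≤0 = subst₂ _≤_ refl (-‿inverseˡ (fromℕ (suc m)))
              (+-monoʳ-≤ (- fromℕ (suc m)) (x≤x+y 1# (fromℕ-nonneg m)))

  n≤x⇒n≤⌊x⌋ : (⌊_⌋ : Carrier → ℤ) → IsFloor ⌊_⌋ → ∀ n {x} → fromℕ n ≤ x → fromℕ n ≤ fromℤ ⌊ x ⌋
  n≤x⇒n≤⌊x⌋ ⌊_⌋ isFloor n {x} n≤x = n<z+1⇒n≤z n ⌊ x ⌋ (≤-<-trans n≤x (proj₂ (isFloor x)))

  Σ-cong : ∀ {n} {f g : Fin n → Carrier} → (∀ i → f i ≡ g i) → Σ f ≡ Σ g
  Σ-cong {zero}  f≡g = refl
  Σ-cong {suc n} f≡g = cong₂ _+_ (f≡g Fin.zero) (Σ-cong (λ i → f≡g (Fin.suc i)))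

  Σ-mono-≤ : ∀ {n} {f g : Fin n → Carrier} → (∀ i → f i ≤ g i) → Σ f ≤ Σ g
  Σ-mono-≤ {zero}  f≤g = ≤-refl
  Σ-mono-≤ {suc n} f≤g = +-mono-≤ (f≤g Fin.zero) (Σ-mono-≤ (λ i → f≤g (Fin.suc i)))

  Σ-nonneg : ∀ {n} {f : Fin n → Carrier} → Nonneg f → 0# ≤ Σ f
  Σ-nonneg {zero}  0≤f = ≤-refl
  Σ-nonneg {suc n} 0≤f =
    subst₂ _≤_ (+-identityˡ 0#) refl (+-mono-≤ (0≤f Fin.zero) (Σ-nonneg (λ i → 0≤f (Fin.suc i))))

  term≤Σ : ∀ {n} {f : Fin n → Carrier} → Nonneg f → ∀ j → f j ≤ Σ f
  term≤Σ {suc n} {f} 0≤f Fin.zero    = x≤x+y (f Fin.zero) (Σ-nonneg (λ i → 0≤f (Fin.suc i)))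
  term≤Σ {suc n} {f} 0≤f (Fin.suc j) =
    subst₂ _≤_ (+-identityˡ _) refl (+-mono-≤ (0≤f Fin.zero) (term≤Σ (λ i → 0≤f (Fin.suc i)) j))

  *-distribˡ-Σ : ∀ {n} c (f : Fin n → Carrier) → c * Σ f ≡ Σ (λ i → c * f i)
  *-distribˡ-Σ {zero}  c f = zeroʳ c
  *-distribˡ-Σ {suc n} c f =
    trans (distribˡ c _ _) (cong (c * f Fin.zero +_) (*-distribˡ-Σ c (λ i → f (Fin.suc i))))

  Σ-1≡fromℕ : ∀ n → Σ {n} (λ _ → 1#) ≡ fromℕ n
  Σ-1≡fromℕ zero    = refl
  Σ-1≡fromℕ (suc n) = cong (1# +_) (Σ-1≡fromℕ n)

  Σ-init-last : ∀ m (f : Fin (suc m) → Carrier) → Σ f ≡ Σ (λ i → f (inject₁ i)) + f (Fin.fromℕ m)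
  Σ-init-last zero    f = trans (+-identityʳ _) (sym (+-identityˡ _))
  Σ-init-last (suc m) f =
    trans (cong (f Fin.zero +_) (Σ-init-last m (λ i → f (Fin.suc i)))) (sym (+-assoc _ _ _))

  αkv·z≡Σinit+last/v : ∀ m v (z : Fin (suc m) → Carrier) →
                       αkv (suc m) v · z ≡ Σ (λ i → z (inject₁ i)) + fromℕ v ⁻¹ * z (Fin.fromℕ m)
  αkv·z≡Σinit+last/v m v z =
    trans (Σ-init-last m (λ i → αkv (suc m) v i * z i))
          (cong₂ _+_ (Σ-cong λ i → trans (coeff-init i) (*-identityˡ _)) coeff-last)
    where
    coeff-init : ∀ i → αkv (suc m) v (inject₁ i) * z (inject₁ i) ≡ 1# * z (inject₁ i)
    coeff-init i rewrite toℕ-inject₁-≡ᵇ m i = refl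
    coeff-last : αkv (suc m) v (Fin.fromℕ m) * z (Fin.fromℕ m) ≡ fromℕ v ⁻¹ * z (Fin.fromℕ m)
    coeff-last rewrite toℕ-fromℕ-≡ᵇ m = refl

module Rounding (R : RealField) (⌊_⌋ : RealField.Carrier R → ℤ) (isFloor : RealOps.IsFloor R ⌊_⌋)
                (m w : ℕ) where
  open RealField R
  open RealOps R
  open OrderedField R
  open IsCommutativeRing isCommutativeRing using (+-comm; distribˡ; +-identityˡ; +-identityʳ; *-identityʳ)
  open IsTotalOrder isTotalOrder using (total) renaming (trans to ≤-trans)
  open CommutativeSemigroupProperties (CommutativeRing.*-commutativeSemigroup commutativeRing)
    using (x∙yz≈y∙xz)
  open PosetReasoning poset

  k v : Carrier
  k = fromℕ (suc m)
  v = fromℕ (suc w)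

  0≤v : 0# ≤ v
  0≤v = fromℕ-nonneg (suc w)

  v≢0 : ¬ v ≡ 0#
  v≢0 = fromℕ-suc≢0 w

  last : Fin (suc m)
  last = Fin.fromℕ m

  round : Carrier → Carrier
  round t = fromℤ ⌊ k * t ⌋

  round-nonneg : ∀ {t} → 0# ≤ t → 0# ≤ round t
  round-nonneg 0≤t = n≤x⇒n≤⌊x⌋ ⌊_⌋ isFloor 0 (*-nonneg (fromℕ-nonneg (suc m)) 0≤t)

  module _ (x : Fin (suc m) → Carrier) (0≤x : Nonneg x) where

    0≤round-init : Nonneg (λ i → round (x (inject₁ i)))
    0≤round-init i = round-nonneg (0≤x (inject₁ i))

    some-large : ∀ j → 1# ≤ k * x (inject₁ j) →
                 1# ≤ Σ (λ i → round (x (inject₁ i))) + v ⁻¹ * round (x last)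
    some-large j 1≤kxⱼ = ≤-trans (≤-trans 1≤roundⱼ (term≤Σ 0≤round-init j)) (x≤x+y _ 0≤last)
      where
      1≤roundⱼ : 1# ≤ round (x (inject₁ j))
      1≤roundⱼ = subst₂ _≤_ (+-identityʳ 1#) refl
                   (n≤x⇒n≤⌊x⌋ ⌊_⌋ isFloor 1 (subst₂ _≤_ (sym (+-identityʳ 1#)) refl 1≤kxⱼ))
      0≤last : 0# ≤ v ⁻¹ * round (x last)
      0≤last = *-nonneg (0≤x⇒0≤x⁻¹ 0≤v v≢0) (round-nonneg (0≤x last))

    all-small : 1# ≤ Σ (λ i → x (inject₁ i)) + v ⁻¹ * x last → (∀ i → k * x (inject₁ i) ≤ 1#) →
                1# ≤ v ⁻¹ * round (x last)
    all-small 1≤αx kx≤1 = x≤y⇒1≤x⁻¹*y 0≤v v≢0 (n≤x⇒n≤⌊x⌋ ⌊_⌋ isFloor (suc w) v≤kxₖ)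
      where
      kxₖ/v : Carrier
      kxₖ/v = v ⁻¹ * (k * x last)
      m+1≤m+kxₖ/v : fromℕ m + 1# ≤ fromℕ m + kxₖ/v
      m+1≤m+kxₖ/v = begin
        fromℕ m + 1#                                       ≡⟨ +-comm (fromℕ m) 1# ⟩
        k                                                  ≡⟨ *-identityʳ k ⟨
        k * 1#                                             ≤⟨ *-monoˡ-≤ k (fromℕ-nonneg (suc m)) 1≤αx ⟩
        k * (Σ (λ i → x (inject₁ i)) + v ⁻¹ * x last)      ≡⟨ distribˡ k _ _ ⟩
        k * Σ (λ i → x (inject₁ i)) + k * (v ⁻¹ * x last)  ≡⟨ cong₂ _+_ (*-distribˡ-Σ k (λ i → x (inject₁ i)))
                                                                         (x∙yz≈y∙xz k (v ⁻¹) (x last)) ⟩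
        Σ (λ i → k * x (inject₁ i)) + kxₖ/v                ≤⟨ +-monoˡ-≤ kxₖ/v (Σ-mono-≤ kx≤1) ⟩
        Σ {m} (λ _ → 1#) + kxₖ/v                           ≡⟨ cong (_+ kxₖ/v) (Σ-1≡fromℕ m) ⟩
        fromℕ m + kxₖ/v                                    ∎
      v≤kxₖ : v ≤ k * x last
      v≤kxₖ = 1≤x⁻¹*y⇒x≤y 0≤v v≢0 (+-cancelˡ-≤ (fromℕ m) m+1≤m+kxₖ/v)

    rounded : 1# ≤ Σ (λ i → x (inject₁ i)) + v ⁻¹ * x last →
              1# ≤ Σ (λ i → round (x (inject₁ i))) + v ⁻¹ * round (x last)
    rounded 1≤αx with ∃⊎∀ (λ i → total 1# (k * x (inject₁ i)))
    ... | inj₁ (j , 1≤kxⱼ) = some-large j 1≤kxⱼ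
    ... | inj₂ kx≤1        = subst₂ _≤_ (+-identityˡ 1#) refl
                               (+-mono-≤ (Σ-nonneg 0≤round-init) (all-small 1≤αx kx≤1))

  roundable : Roundable ⌊_⌋ k (αkv (suc m) (suc w))
  roundable x 0≤x 1≤αx = subst₂ _≤_ refl (sym (split (λ i → round (x i))))
                           (rounded x 0≤x (subst₂ _≤_ refl (split x) 1≤αx))
    where
    split : ∀ z → αkv (suc m) (suc w) · z ≡ Σ (λ i → z (inject₁ i)) + v ⁻¹ * z last
    split = αkv·z≡Σinit+last/v m (suc w)

lemma1 : (R : RealField) → (⌊_⌋ : RealField.Carrier R → ℤ) → RealOps.IsFloor R ⌊_⌋ →
    (k v : ℕ) → 2 ℕ.≤ k → 1 ℕ.≤ v →
    RealOps.Roundable R ⌊_⌋ (RealOps.fromℕ R k) (RealOps.αkv R k v)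
lemma1 R ⌊_⌋ isFloor (suc m) (suc w) _ _ = Rounding.roundable R ⌊_⌋ isFloor m w
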